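{- Let $c=\frac14\left(\sqrt6-\frac32\right)$. There exist constants $C>0$ and $t_0$ such that for every integer $t\ge t_0$, every $2$-coloring of the edges of the complete graph on $2^t$ vertices contains at least $2^{ct^2-Ct\log_2 t}$ distinct monochromatic complete subgraphs of size at most $t/2$.
   Context: A $2$-coloring of the edges of a complete graph assigns to each edge one of two colors, red or blue. A monochromatic complete subgraph is a set $S$ of vertices such that all edges with both endpoints in $S$ have the same color; they are counted as vertex sets, each set once, and the size of $S$ is $|S|$. -}

module Defs where

open import Data.Nat using (ℕ; _+_; _*_; _^_; _≤_)
open import Data.Bool using (Bool)
open import Data.Fin using (Fin) renaming (_<_ to _<ᶠ_)
open import Data.Fin.Subset using (Subset; _∈_; ∣_∣)
open import Data.Product using (Σ; ∃; _×_)
open import Relation.Binary.PropositionalEquality using (_≡_)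
open import Function.Definitions using (Injective)

-- Only the values χ i j with i < j are used (edge {i,j} with i < j gets colour χ i j),
-- so every function Fin n → Fin n → Bool is exactly one colouring.
Colouring : ℕ → Set
Colouring n = Fin n → Fin n → Bool

Monochromatic : ∀ {n} → Colouring n → Subset n → Set
Monochromatic {n} χ S =
  Σ Bool λ b → ∀ (i j : Fin n) → i ∈ S → j ∈ S → i <ᶠ j → χ i j ≡ b

Good : ∀ {n} → ℕ → Colouring n → Subset n → Set
Good t χ S = Monochromatic χ S × (2 * ∣ S ∣ ≤ t)

AtLeastGood : ∀ {n} → ℕ → Colouring n → ℕ → Set
AtLeastGood {n} t χ N =
  Σ (Fin N → Subset n) λ f → Injective _≡_ _≡_ f × (∀ k → Good t χ (f k))

-- PowLe t M  encodes the real inequality  2^(c t²) ≤ M  with c = (√6 − 3/2)/4.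
-- Since √6 is irrational, 2^(c t²) ≤ M holds iff for every nonnegative rational
-- p/q < √6 (equivalently p² ≤ 6q²) we have 2^((p/q − 3/2) t² / 4) ≤ M, i.e.
-- (raising to the power 8q) 2^(2p t²) ≤ M^(8q) · 2^(3q t²).
PowLe : ℕ → ℕ → Set
PowLe t M = ∀ (p q : ℕ) → p * p ≤ 6 * (q * q) →
  2 ^ (2 * p * (t * t)) ≤ M ^ (8 * q) * 2 ^ (3 * q * (t * t))

-- Among 2 ^ (x + 1) vertices, at least half have neighbourhoods of size 2 ^ x in one common colour
-- d. Following a colour pattern P of length 2 k, descend into such neighbourhoods, putting the vertex
-- into the clique at every step of P coloured d: a step through 2 ^ x candidates multiplies the
-- number of cliques by 2 ^ x, up to the number of orders in which a clique can be built.
-- By induction on the length of the patterns, if 2 ^ T ≤ max (yield P, yield P̄) for every pattern, one colour has 2 ^ T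
-- distinct monochromatic cliques of size k. Bounding the yield of a pattern below in terms of the
-- number m of falses before its k-th true leaves a quadratic optimisation in m / k whose value,
-- (√6 − 3/2) k² = c t², gives the theorem; overcounting and rounding cost O(t log t) in the exponent.
module Submission where

open import Defs
open import Data.Nat using (ℕ; _*_; _^_; _≤_; _<_)
open import Data.Product using (Σ; ∃; _×_)

open import Data.Nat using (zero; suc; _+_; _∸_; z≤n; s≤s; s≤s⁻¹; _⊔_; pred; _≤?_)
open import Data.Nat.Properties
open import Data.Nat.Tactic.RingSolver using (solve-∀)
open import Data.Bool using (Bool; true; false; not) renaming (_≟_ to _≟ᵇ_)
open import Data.Bool.Properties using (not-involutive)
open import Data.Fin as Fin using (Fin; zero; suc; toℕ) renaming (_<_ to _<ᶠ_)
import Data.Fin.Properties as Finₚ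
open import Data.Fin.Subset using (Subset; _∈_; _∉_; ∣_∣; ⊥)
open import Data.Fin.Subset.Properties using (∉⊥; ∣⊥∣≡0)
open import Data.Vec as Vec using (_∷_; here; there)
import Data.Vec.Properties as Vecₚ
open import Data.List as List using (List; []; _∷_; length; tabulate; deduplicate; filter; replicate)
import Data.List.Properties as Listₚ
open import Data.List.Relation.Unary.Any as Any using (here; there)
open import Data.List.Relation.Unary.Any.Properties as Anyₚ using ()
open import Data.List.Relation.Unary.All as All using ()
open import Data.List.Relation.Unary.AllPairs using (_∷_)
open import Data.List.Membership.Propositional using () renaming (_∈_ to _∈ₗ_)
open import Data.List.Extrema.Nat using (argmin; f[argmin]≤f[xs]; argmin-sel)
import Data.List.Membership.Propositional.Properties as ∈ₚ
open import Data.List.Relation.Unary.Unique.Propositional using (Unique)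
import Data.List.Relation.Unary.Unique.Propositional.Properties as Uniqueₚ
import Data.List.Relation.Unary.Unique.DecPropositional.Properties as DecUniqueₚ
open import Data.Product using (_,_; proj₁; proj₂; uncurry)
open import Data.Sum as Sum using (_⊎_; inj₁; inj₂; swap; [_,_]′)
open import Data.Empty using (⊥-elim)
open import Relation.Nullary using (Dec; yes; no; does; ¬?)
open import Relation.Binary.Definitions using (DecidableEquality)
open import Relation.Binary.PropositionalEquality
  using (_≡_; _≢_; refl; sym; trans; cong; cong₂; subst)
open import Function.Base using (_∘_; id)
open import Function.Definitions using (Injective)

insert : ∀ {n} → Fin n → Subset n → Subset n
insert zero    (_ ∷ S) = true ∷ S
insert (suc v) (x ∷ S) = x ∷ insert v S

∣insert∣≤ : ∀ {n} (v : Fin n) (S : Subset n) → ∣ insert v S ∣ ≤ suc ∣ S ∣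
∣insert∣≤ zero    (true  ∷ S) = n≤1+n _
∣insert∣≤ zero    (false ∷ S) = ≤-refl
∣insert∣≤ (suc v) (true  ∷ S) = s≤s (∣insert∣≤ v S)
∣insert∣≤ (suc v) (false ∷ S) = ∣insert∣≤ v S

v∈insert : ∀ {n} (v : Fin n) (S : Subset n) → v ∈ insert v S
v∈insert zero    (_ ∷ S) = here
v∈insert (suc v) (_ ∷ S) = there (v∈insert v S)

∈insert⁻ : ∀ {n} (v : Fin n) (S : Subset n) {i} → i ∈ insert v S → i ≡ v ⊎ i ∈ S
∈insert⁻ zero    (_ ∷ S) here      = inj₁ refl
∈insert⁻ zero    (_ ∷ S) (there p) = inj₂ (there p)
∈insert⁻ (suc v) (_ ∷ S) here      = inj₂ here
∈insert⁻ (suc v) (_ ∷ S) (there p) with ∈insert⁻ v S p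
... | inj₁ refl = inj₁ refl
... | inj₂ q    = inj₂ (there q)

insert-cancel : ∀ {n} (v : Fin n) {A B : Subset n} → v ∉ A → v ∉ B → insert v A ≡ insert v B → A ≡ B
insert-cancel zero    {true  ∷ A} {_}       v∉A v∉B eq   = ⊥-elim (v∉A here)
insert-cancel zero    {false ∷ A} {true ∷ B} v∉A v∉B eq  = ⊥-elim (v∉B here)
insert-cancel zero    {false ∷ A} {false ∷ B} v∉A v∉B refl = refl
insert-cancel (suc v) {x ∷ A}     {y ∷ B}   v∉A v∉B eq   =
  cong₂ _∷_ (cong Vec.head eq)
    (insert-cancel v (v∉A ∘ there) (v∉B ∘ there) (cong Vec.tail eq))

rank : ∀ {n} → Subset n → Fin n → ℕ
rank (_     ∷ S) zero    = 0
rank (true  ∷ S) (suc v) = suc (rank S v)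
rank (false ∷ S) (suc v) = rank S v

rank<∣S∣ : ∀ {n} (S : Subset n) {v} → v ∈ S → rank S v < ∣ S ∣
rank<∣S∣ (true  ∷ S) here      = s≤s z≤n
rank<∣S∣ (true  ∷ S) (there p) = s≤s (rank<∣S∣ S p)
rank<∣S∣ (false ∷ S) (there p) = rank<∣S∣ S p

rank-injective : ∀ {n} (S : Subset n) {v w} → v ∈ S → w ∈ S → rank S v ≡ rank S w → v ≡ w
rank-injective (x     ∷ S) here      here      _  = refl
rank-injective (true  ∷ S) (there p) (there q) eq = cong suc (rank-injective S p q (suc-injective eq))
rank-injective (false ∷ S) (there p) (there q) eq = cong suc (rank-injective S p q eq)

insert-rank-injective : ∀ {n} {v v′ : Fin n} {S S′ : Subset n} → v ∉ S → v′ ∉ S′ →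
  insert v S ≡ insert v′ S′ → rank (insert v S) v ≡ rank (insert v′ S′) v′ → v ≡ v′ × S ≡ S′
insert-rank-injective {v = v} {v′} {S} {S′} v∉S v′∉S′ same-set same-rank
  with refl ← rank-injective (insert v S) (v∈insert v S) (subst (v′ ∈_) (sym same-set) (v∈insert v′ S′))
                (trans same-rank (cong (λ T → rank T v′) (sym same-set)))
  = refl , insert-cancel v v∉S v′∉S′ same-set

lookup-injective : ∀ {A : Set} {xs : List A} → Unique xs → Injective _≡_ _≡_ (List.lookup xs)
lookup-injective {xs = _ ∷ _}  _       {zero}  {zero}  _  = refl
lookup-injective {xs = _ ∷ _}  (x∉ ∷ _) {zero}  {suc j} eq = ⊥-elim (All.lookup x∉ (∈ₚ.∈-lookup j) eq)
lookup-injective {xs = _ ∷ _}  (x∉ ∷ _) {suc i} {zero}  eq = ⊥-elim (All.lookup x∉ (∈ₚ.∈-lookup i) (sym eq))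
lookup-injective {xs = _ ∷ xs} (_ ∷ u)  {suc i} {suc j} eq = cong suc (lookup-injective u eq)

distinctValues : ∀ {M a} {B : Set} → DecidableEquality B → (h : Fin M → B) (label : Fin M → Fin a) →
  (∀ {i j} → h i ≡ h j → label i ≡ label j → i ≡ j) →
  Σ ℕ λ N → Σ (Fin N → B) (λ g → Injective _≡_ _≡_ g × (∀ k → ∃ λ i → g k ≡ h i)) × M ≤ N * a
distinctValues {M} {a} {B} _≟_ h label separates =
  length values , (List.lookup values , lookup-injective unique , fromImage) , M≤N*a
  where
  values : List B
  values = deduplicate _≟_ (tabulate h)
  unique : Unique values
  unique = DecUniqueₚ.deduplicate-! _≟_ (tabulate h)
  fromImage : ∀ k → ∃ λ i → List.lookup values k ≡ h i
  fromImage k = ∈ₚ.∈-tabulate⁻ (∈ₚ.∈-deduplicate⁻ _≟_ (tabulate h) (∈ₚ.∈-lookup k))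
  position : ∀ i → h i ∈ₗ values
  position i = ∈ₚ.∈-deduplicate⁺ _≟_ (∈ₚ.∈-tabulate⁺ i)
  code : Fin M → Fin (length values * a)
  code i = Fin.combine (Any.index (position i)) (label i)
  code-injective : Injective _≡_ _≡_ code
  code-injective {i} {j} eq with Finₚ.combine-injective _ (label i) _ (label j) eq
  ... | same-index , same-label = separates h-eq same-label
    where
    h-eq : h i ≡ h j
    h-eq = trans (Anyₚ.lookup-index (position i))
             (trans (cong (List.lookup values) same-index) (sym (Anyₚ.lookup-index (position j))))
  M≤N*a : M ≤ length values * a
  M≤N*a = Finₚ.injective⇒≤ code-injective

pointwise⊎⇒⊎ : ∀ {A : Set} m (Q : Fin m → Set) → (∀ i → Q i ⊎ A) → (∀ i → Q i) ⊎ A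
pointwise⊎⇒⊎ zero    Q f = inj₁ λ ()
pointwise⊎⇒⊎ (suc m) Q f with f zero | pointwise⊎⇒⊎ m (λ i → Q (suc i)) (λ i → f (suc i))
... | inj₂ a  | _        = inj₂ a
... | inj₁ q  | inj₂ a   = inj₂ a
... | inj₁ q  | inj₁ qs  = inj₁ λ { zero → q ; (suc i) → qs i }

length-filter-true+false : ∀ {A : Set} (f : A → Bool) xs →
  length (filter (λ y → f y ≟ᵇ true) xs) + length (filter (λ y → f y ≟ᵇ false) xs) ≡ length xs
length-filter-true+false f []       = refl
length-filter-true+false f (y ∷ ys) with f y
... | true  = cong suc (length-filter-true+false f ys)
... | false = trans (+-suc _ _) (cong suc (length-filter-true+false f ys))

half-large : ∀ {K A B} → 2 * K ≤ A + B → A ≤ K → K ≤ B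
half-large {K} {A} {B} 2K≤A+B A≤K =
  +-cancelˡ-≤ K K B (≤-trans (≤-reflexive (cong (K +_) (sym (+-identityʳ K)))) (≤-trans 2K≤A+B (+-monoˡ-≤ B A≤K)))

nonempty⇒∈ : ∀ {A : Set} (xs : List A) → 0 < length xs → ∃ λ x → x ∈ₗ xs
nonempty⇒∈ (x ∷ _) _ = x , here refl

remQuot-injective : ∀ {n} k {ι ι′ : Fin (n * k)} → Fin.remQuot {n} k ι ≡ Fin.remQuot k ι′ → ι ≡ ι′
remQuot-injective {n} k {ι} {ι′} eq =
  trans (sym (Finₚ.combine-remQuot {n} k ι)) (trans (cong (uncurry Fin.combine) eq) (Finₚ.combine-remQuot {n} k ι′))

-- Colour patterns

-- Following a pattern P from 2 ^ x vertices, every step passes to a monochromatic neighbourhood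
-- of half the size, and a true step also puts the current vertex, one of a class of 2 ^ (x − 1),
-- into the clique. A clique of size at most 2 ^ (ℓ − 1) is built in at most that many ways, so such
-- a step multiplies the number of cliques by 2 ^ (x ∸ ℓ), and yield ℓ x a P is log₂ of the number
-- of cliques of size a obtained along P.
yield : (ℓ x a : ℕ) → List Bool → ℕ
yield ℓ x zero    P           = 0
yield ℓ x (suc a) []          = 0
yield ℓ x (suc a) (true  ∷ P) = (x ∸ ℓ) + yield ℓ (pred x) a P
yield ℓ x (suc a) (false ∷ P) = yield ℓ (pred x) (suc a) P

yieldFor : ℕ → Bool → (x a : ℕ) → List Bool → ℕ
yieldFor ℓ true  x a P = yield ℓ x a P
yieldFor ℓ false x a P = yield ℓ x a (List.map not P)

yieldFor-[] : ∀ ℓ c x a → yieldFor ℓ c x a [] ≡ 0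
yieldFor-[] ℓ true  x zero    = refl
yieldFor-[] ℓ true  x (suc a) = refl
yieldFor-[] ℓ false x zero    = refl
yieldFor-[] ℓ false x (suc a) = refl

yieldFor-zero : ∀ ℓ c x P → yieldFor ℓ c x 0 P ≡ 0
yieldFor-zero ℓ true  x P = refl
yieldFor-zero ℓ false x P = refl

yieldFor-own : ∀ ℓ c x a P → yieldFor ℓ c x (suc a) (c ∷ P) ≡ (x ∸ ℓ) + yieldFor ℓ c (pred x) a P
yieldFor-own ℓ true  x a P = refl
yieldFor-own ℓ false x a P = refl

yieldFor-other : ∀ ℓ d x a P → yieldFor ℓ (not d) x a (d ∷ P) ≡ yieldFor ℓ (not d) (pred x) a P
yieldFor-other ℓ true  x zero    P = refl
yieldFor-other ℓ true  x (suc a) P = refl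
yieldFor-other ℓ false x zero    P = refl
yieldFor-other ℓ false x (suc a) P = refl

record Yields (ℓ n x : ℕ) (c : Bool) (a u b w : ℕ) : Set where
  constructor mkYields
  field
    at : ∀ P → length P ≡ n → u ≤ yieldFor ℓ c x a P ⊎ w ≤ yieldFor ℓ (not c) x b P

Yields-swap : ∀ {ℓ n x} c {a u b w} → Yields ℓ n x (not c) a u b w → Yields ℓ n x c b w a u
Yields-swap true  yields = mkYields λ P len → swap (Yields.at yields P len)
Yields-swap false yields = mkYields λ P len → swap (Yields.at yields P len)

Yields-[] : ∀ {ℓ x c a u b w} → Yields ℓ 0 x c a u b w → u ≡ 0 ⊎ w ≡ 0
Yields-[] {ℓ} {x} {c} {a} {b = b} yields with Yields.at yields [] refl
... | inj₁ u≤ = inj₁ (n≤0⇒n≡0 (subst (_ ≤_) (yieldFor-[] ℓ c x a) u≤))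
... | inj₂ w≤ = inj₂ (n≤0⇒n≡0 (subst (_ ≤_) (yieldFor-[] ℓ (not c) x b) w≤))

yieldFor-other-≤ : ∀ {ℓ d x b w P} → w ≤ yieldFor ℓ (not d) (suc x) b (d ∷ P) → w ≤ yieldFor ℓ (not d) x b P
yieldFor-other-≤ {ℓ} {d} {x} {b} {P = P} = subst (_ ≤_) (yieldFor-other ℓ d (suc x) b P)

Yields-own : ∀ {ℓ n x d a u b w} → Yields ℓ (suc n) (suc x) d (suc a) u b w →
  Yields ℓ n x d a (u ∸ (suc x ∸ ℓ)) b w
Yields-own {ℓ} {n} {x} {d} {a} {u} yields =
  mkYields λ P len → Sum.map (own P) (yieldFor-other-≤ {d = d}) (Yields.at yields (d ∷ P) (cong suc len))
  where
  own : ∀ P → u ≤ yieldFor ℓ d (suc x) (suc a) (d ∷ P) → u ∸ (suc x ∸ ℓ) ≤ yieldFor ℓ d x a P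
  own P u≤ = m≤n+o⇒m∸n≤o u (suc x ∸ ℓ) (subst (u ≤_) (yieldFor-own ℓ d (suc x) a P) u≤)

Yields-zero : ∀ {ℓ n x d u b w} → Yields ℓ (suc n) (suc x) d 0 u b w → Yields ℓ n x d 0 u b w
Yields-zero {ℓ} {n} {x} {d} {u} yields =
  mkYields λ P len → Sum.map (own P) (yieldFor-other-≤ {d = d}) (Yields.at yields (d ∷ P) (cong suc len))
  where
  own : ∀ P → u ≤ yieldFor ℓ d (suc x) 0 (d ∷ P) → u ≤ yieldFor ℓ d x 0 P
  own P = subst (u ≤_) (trans (yieldFor-zero ℓ d (suc x) (d ∷ P)) (sym (yieldFor-zero ℓ d x P)))

-- The greedy recursion in a coloured complete graph

m+n≤o+[m∸[o∸n]] : ∀ m {n o} → n ≤ o → m + n ≤ o + (m ∸ (o ∸ n))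
m+n≤o+[m∸[o∸n]] m {n} {o} n≤o = begin
  m + n             ≤⟨ +-monoˡ-≤ n (m≤n+m∸n m g) ⟩
  (g + (m ∸ g)) + n ≡⟨ swap-last g (m ∸ g) n ⟩
  (g + n) + (m ∸ g) ≡⟨ cong (_+ (m ∸ g)) (m∸n+n≡m n≤o) ⟩
  o + (m ∸ g)       ∎
  where
  open ≤-Reasoning
  g = o ∸ n
  swap-last : ∀ a b c → (a + b) + c ≡ (a + c) + b
  swap-last = solve-∀

many-cliques : ∀ {u x lg a G M′} → lg ≤ x → suc a ≤ 2 ^ lg → 2 ^ x ≤ G →
  G * 2 ^ (u ∸ (x ∸ lg)) ≤ M′ * suc a → 2 ^ u ≤ M′
many-cliques {u} {x} {lg} {a} {G} {M′} lg≤x a<2^lg 2^x≤G bound = *-cancelʳ-≤ (2 ^ u) M′ (suc a) (begin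
  2 ^ u * suc a  ≤⟨ *-monoʳ-≤ (2 ^ u) a<2^lg ⟩
  2 ^ u * 2 ^ lg ≡⟨ sym (^-distribˡ-+-* 2 u lg) ⟩
  2 ^ (u + lg)   ≤⟨ ^-monoʳ-≤ 2 (m+n≤o+[m∸[o∸n]] u lg≤x) ⟩
  2 ^ (x + u′)   ≡⟨ ^-distribˡ-+-* 2 x u′ ⟩
  2 ^ x * 2 ^ u′ ≤⟨ *-monoˡ-≤ (2 ^ u′) 2^x≤G ⟩
  G * 2 ^ u′     ≤⟨ bound ⟩
  M′ * suc a     ∎)
  where
  open ≤-Reasoning
  u′ = u ∸ (x ∸ lg)

module Greedy {N : ℕ} (χ : Colouring N) where

  colour : Fin N → Fin N → Bool
  colour v w with v Finₚ.<? w
  ... | yes _ = χ v w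
  ... | no  _ = χ w v

  colour-< : ∀ {v w} → v <ᶠ w → colour v w ≡ χ v w
  colour-< {v} {w} v<w with v Finₚ.<? w
  ... | yes _   = refl
  ... | no v≮w = ⊥-elim (v≮w v<w)

  colour-> : ∀ {v w} → w <ᶠ v → colour v w ≡ χ w v
  colour-> {v} {w} w<v with v Finₚ.<? w
  ... | yes v<w = ⊥-elim (Finₚ.<-asym w<v v<w)
  ... | no  _   = refl

  Clique : Bool → Subset N → Set
  Clique c S = ∀ i j → i ∈ S → j ∈ S → i <ᶠ j → χ i j ≡ c

  record SmallClique (c : Bool) (X : List (Fin N)) (a : ℕ) (S : Subset N) : Set where
    field
      clique : Clique c S
      ⊆X     : ∀ {y} → y ∈ S → y ∈ₗ X
      size   : ∣ S ∣ ≤ a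

  open SmallClique

  Cliques : Bool → List (Fin N) → (a M : ℕ) → Set
  Cliques c X a M = Σ (Fin M → Subset N) λ f → Injective _≡_ _≡_ f × (∀ i → SmallClique c X a (f i))

  Cliques-⊆ : ∀ {c X Y a M} → (∀ {y} → y ∈ₗ X → y ∈ₗ Y) → Cliques c X a M → Cliques c Y a M
  Cliques-⊆ X⊆Y (f , f-inj , small) =
    f , f-inj , λ i → record { clique = clique (small i) ; ⊆X = X⊆Y ∘ ⊆X (small i) ; size = size (small i) }

  Cliques-≤ : ∀ {c X a M M′} → M′ ≤ M → Cliques c X a M → Cliques c X a M′
  Cliques-≤ M′≤M (f , f-inj , small) =
    (λ i → f (Fin.inject≤ i M′≤M)) , (λ eq → Finₚ.inject≤-injective M′≤M M′≤M _ _ (f-inj eq)) ,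
    λ i → small (Fin.inject≤ i M′≤M)

  Cliques-1 : ∀ {c X a} → Cliques c X a 1
  Cliques-1 {a = a} = (λ _ → ⊥) , (λ { {zero} {zero} _ → refl }) , λ _ → record
    { clique = λ _ _ i∈⊥ _ _ → ⊥-elim (∉⊥ i∈⊥)
    ; ⊆X     = λ y∈⊥ → ⊥-elim (∉⊥ y∈⊥)
    ; size   = subst (_≤ a) (sym (∣⊥∣≡0 N)) z≤n
    }

  others : Fin N → List (Fin N) → List (Fin N)
  others v = filter (λ w → ¬? (w Fin.≟ v))

  nbhd : Bool → Fin N → List (Fin N) → List (Fin N)
  nbhd d v X = filter (λ w → colour v w ≟ᵇ d) (others v X)

  ∈nbhd⁻ : ∀ {d v X w} → w ∈ₗ nbhd d v X → (w ∈ₗ X × w ≢ v) × colour v w ≡ d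
  ∈nbhd⁻ {d} {v} {X} w∈ with ∈ₚ.∈-filter⁻ (λ w → colour v w ≟ᵇ d) {xs = others v X} w∈
  ... | w∈others , vw≡d = ∈ₚ.∈-filter⁻ (λ w → ¬? (w Fin.≟ v)) {xs = X} w∈others , vw≡d

  nbhd-unique : ∀ {d v X} → Unique X → Unique (nbhd d v X)
  nbhd-unique {d} {v} uX = Uniqueₚ.filter⁺ (λ w → colour v w ≟ᵇ d) (Uniqueₚ.filter⁺ (λ w → ¬? (w Fin.≟ v)) uX)

  nbhd⊆ : ∀ {d v X y} → y ∈ₗ nbhd d v X → y ∈ₗ X
  nbhd⊆ y∈ = proj₁ (proj₁ (∈nbhd⁻ y∈))

  insert-clique : ∀ {c v X S} → Clique c S → (∀ {w} → w ∈ S → w ∈ₗ nbhd c v X) → Clique c (insert v S)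
  insert-clique {v = v} {X} {S} cl S⊆nbhd i j i∈ j∈ i<j with ∈insert⁻ v S i∈ | ∈insert⁻ v S j∈
  ... | inj₁ refl | inj₁ refl = ⊥-elim (Finₚ.<-irrefl refl i<j)
  ... | inj₁ refl | inj₂ j∈S  = trans (sym (colour-< i<j)) (proj₂ (∈nbhd⁻ {X = X} (S⊆nbhd j∈S)))
  ... | inj₂ i∈S  | inj₁ refl = trans (sym (colour-> i<j)) (proj₂ (∈nbhd⁻ {X = X} (S⊆nbhd i∈S)))
  ... | inj₂ i∈S  | inj₂ j∈S  = cl i j i∈S j∈S i<j

  insert-small : ∀ {c v X a S} → v ∈ₗ X → SmallClique c (nbhd c v X) a S → SmallClique c X (suc a) (insert v S)
  insert-small {v = v} {X} {S = S} v∈X small = record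
    { clique = insert-clique {X = X} (clique small) (⊆X small)
    ; ⊆X     = λ y∈ → [ (λ { refl → v∈X }) , nbhd⊆ ∘ ⊆X small ]′ (∈insert⁻ v S y∈)
    ; size   = ≤-trans (∣insert∣≤ v S) (s≤s (size small))
    }

  length-others : ∀ {v X} → Unique X → v ∈ₗ X → suc (length (others v X)) ≡ length X
  length-others {v} {_ ∷ ys} (x∉ ∷ _) (here refl)
    rewrite Listₚ.filter-reject (λ w → ¬? (w Fin.≟ v)) {x = v} {xs = ys} (λ v≢v → v≢v refl)
          | Listₚ.filter-all (λ w → ¬? (w Fin.≟ v)) {xs = ys} (All.map (λ v≢w w≡v → v≢w (sym w≡v)) x∉) = refl
  length-others {v} {y ∷ ys} (y∉ ∷ u) (there v∈)
    rewrite Listₚ.filter-accept (λ w → ¬? (w Fin.≟ v)) {x = y} {xs = ys} (All.lookup y∉ v∈) =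
    cong suc (length-others u v∈)

  length-nbhds : ∀ {v X} → Unique X → v ∈ₗ X → suc (length (nbhd true v X) + length (nbhd false v X)) ≡ length X
  length-nbhds {v} {X} uX v∈X = trans (cong suc (length-filter-true+false (colour v) (others v X))) (length-others uX v∈X)

  majority : ℕ → List (Fin N) → Fin N → Bool
  majority x X v = does (2 ^ x ≤? length (nbhd true v X))

  nbhd-majority : ∀ {x X v} → Unique X → v ∈ₗ X → 2 ^ suc x ≤ length X →
    2 ^ x ≤ length (nbhd (majority x X v) v X)
  nbhd-majority {x} {X} {v} uX v∈X large = byCases (2 ^ x ≤? length (nbhd true v X))
    where
    byCases : (dec : Dec (2 ^ x ≤ length (nbhd true v X))) → 2 ^ x ≤ length (nbhd (does dec) v X)
    byCases (yes big)   = big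
    byCases (no  small) = half-large (≤-trans large (≤-reflexive (sym (length-nbhds uX v∈X)))) (≰⇒> small)

  class : ℕ → List (Fin N) → Bool → List (Fin N)
  class x X d = filter (λ v → majority x X v ≟ᵇ d) X

  ∈class⁻ : ∀ {x X d v} → v ∈ₗ class x X d → v ∈ₗ X × majority x X v ≡ d
  ∈class⁻ {x} {X} {d} = ∈ₚ.∈-filter⁻ (λ v → majority x X v ≟ᵇ d) {xs = X}

  class-unique : ∀ {x X d} → Unique X → Unique (class x X d)
  class-unique {x} {X} {d} = Uniqueₚ.filter⁺ (λ v → majority x X v ≟ᵇ d)

  nbhd-class : ∀ {x X d v} → Unique X → 2 ^ suc x ≤ length X → v ∈ₗ class x X d → 2 ^ x ≤ length (nbhd d v X)
  nbhd-class {x} {X} {d} {v} uX large v∈ =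
    subst (λ e → 2 ^ x ≤ length (nbhd e v X)) (proj₂ (∈class⁻ {x} {X} v∈))
      (nbhd-majority {x} uX (proj₁ (∈class⁻ {x} {X} v∈)) large)

  large-class : ∀ {x X} → 2 ^ suc x ≤ length X → Σ Bool λ d → 2 ^ x ≤ length (class x X d)
  large-class {x} {X} large with 2 ^ x ≤? length (class x X true)
  ... | yes big   = true , big
  ... | no  small = false ,
    half-large (≤-trans large (≤-reflexive (sym (length-filter-true+false (majority x X) X)))) (<⇒≤ (≰⇒> small))

  -- Extending the cliques found in the neighbourhoods of the vertices of G by those vertices counts
  -- every clique of size at most suc a at most suc a times, separated by the rank of the added vertex.
  extendCliques : ∀ {d X a M} (G : List (Fin N)) → Unique G → (∀ {v} → v ∈ₗ G → v ∈ₗ X) →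
    (∀ i → Cliques d (nbhd d (List.lookup G i) X) a M) →
    Σ ℕ λ M′ → Cliques d X (suc a) M′ × length G * M ≤ M′ * suc a
  extendCliques {d} {X} {a} {M} G uG G⊆X cliques =
    let M′ , (g , g-injective , g-values) , bound = distinctValues (Vecₚ.≡-dec _≟ᵇ_) h label separates
    in  M′ , (g , g-injective , small-value ∘ g-values) , bound
    where
    vertex : Fin (length G) → Fin N
    vertex = List.lookup G
    S : Fin (length G) → Fin M → Subset N
    S i = proj₁ (cliques i)
    small : ∀ i j → SmallClique d (nbhd d (vertex i) X) a (S i j)
    small i = proj₂ (proj₂ (cliques i))
    vertex∉ : ∀ i j → vertex i ∉ S i j
    vertex∉ i j v∈ = proj₂ (proj₁ (∈nbhd⁻ {X = X} (⊆X (small i j) v∈))) refl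
    extended : ∀ i j → SmallClique d X (suc a) (insert (vertex i) (S i j))
    extended i j = insert-small (G⊆X (∈ₚ.∈-lookup i)) (small i j)
    pair : Fin (length G * M) → Fin (length G) × Fin M
    pair = Fin.remQuot M
    h : Fin (length G * M) → Subset N
    h ι = insert (vertex (proj₁ (pair ι))) (S (proj₁ (pair ι)) (proj₂ (pair ι)))
    rank<suc-a : ∀ ι → rank (h ι) (vertex (proj₁ (pair ι))) < suc a
    rank<suc-a ι = <-≤-trans (rank<∣S∣ (h ι) (v∈insert _ _)) (size (extended (proj₁ (pair ι)) (proj₂ (pair ι))))
    label : Fin (length G * M) → Fin (suc a)
    label ι = Fin.fromℕ< (rank<suc-a ι)
    pair-separates : ∀ {i j i′ j′} → insert (vertex i) (S i j) ≡ insert (vertex i′) (S i′ j′) →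
      rank (insert (vertex i) (S i j)) (vertex i) ≡ rank (insert (vertex i′) (S i′ j′)) (vertex i′) →
      (i , j) ≡ (i′ , j′)
    pair-separates {i} {j} {i′} {j′} same-set same-rank
      with insert-rank-injective (vertex∉ i j) (vertex∉ i′ j′) same-set same-rank
    ... | same-vertex , same-clique with lookup-injective uG same-vertex
    ... | refl = cong (i ,_) (proj₁ (proj₂ (cliques i)) same-clique)
    separates : ∀ {ι ι′} → h ι ≡ h ι′ → label ι ≡ label ι′ → ι ≡ ι′
    separates {ι} {ι′} same-set same-label = remQuot-injective M (pair-separates same-set
      (trans (sym (Finₚ.toℕ-fromℕ< (rank<suc-a ι))) (trans (cong toℕ same-label) (Finₚ.toℕ-fromℕ< (rank<suc-a ι′)))))
    small-value : ∀ {T} → ∃ (λ ι → T ≡ h ι) → SmallClique d X (suc a) T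
    small-value (ι , refl) = extended (proj₁ (pair ι)) (proj₂ (pair ι))

  GreedyBound : ℕ → ℕ → Set
  GreedyBound lg n = ∀ {x X c a u b w} → n + suc lg ≤ x → Unique X → 2 ^ x ≤ length X →
    a ≤ 2 ^ lg → b ≤ 2 ^ lg → Yields (suc lg) n x c a u b w →
    Cliques c X a (2 ^ u) ⊎ Cliques (not c) X b (2 ^ w)

  module Step {lg n : ℕ} (greedy-n : GreedyBound lg n) {x : ℕ} {X : List (Fin N)} {d : Bool} {b w : ℕ}
              (n+ℓ≤x : n + suc lg ≤ x) (uX : Unique X) (large : 2 ^ suc x ≤ length X) (b≤ : b ≤ 2 ^ lg)
              (largeClass : 2 ^ x ≤ length (class x X d)) where

    G : List (Fin N)
    G = class x X d

    descend : ∀ {v a u} → v ∈ₗ G → a ≤ 2 ^ lg → Yields (suc lg) n x d a u b w →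
      Cliques d (nbhd d v X) a (2 ^ u) ⊎ Cliques (not d) X b (2 ^ w)
    descend v∈G a≤ yields with greedy-n n+ℓ≤x (nbhd-unique uX) (nbhd-class {x} uX large v∈G) a≤ b≤ yields
    ... | inj₁ own   = inj₁ own
    ... | inj₂ other = inj₂ (Cliques-⊆ nbhd⊆ other)

    step-zero : ∀ {u} → Yields (suc lg) (suc n) (suc x) d 0 u b w →
      Cliques d X 0 (2 ^ u) ⊎ Cliques (not d) X b (2 ^ w)
    step-zero yields with nonempty⇒∈ G (≤-trans (m^n>0 2 x) largeClass)
    ... | v , v∈G with descend v∈G z≤n (Yields-zero yields)
    ...   | inj₁ own   = inj₁ (Cliques-⊆ nbhd⊆ own)
    ...   | inj₂ other = inj₂ other

    step-suc : ∀ {a u} → suc a ≤ 2 ^ lg → Yields (suc lg) (suc n) (suc x) d (suc a) u b w →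
      Cliques d X (suc a) (2 ^ u) ⊎ Cliques (not d) X b (2 ^ w)
    step-suc {a} {u} a<2^lg yields
      with pointwise⊎⇒⊎ (length G) (λ i → Cliques d (nbhd d (List.lookup G i) X) a (2 ^ u′))
             (λ i → descend (∈ₚ.∈-lookup i) (≤-trans (n≤1+n a) a<2^lg) (Yields-own yields))
      where u′ = u ∸ (x ∸ lg)
    ... | inj₂ other = inj₂ other
    ... | inj₁ each with extendCliques G (class-unique {x} uX) (proj₁ ∘ ∈class⁻ {x} {X}) each
    ...   | M′ , cliques , bound = inj₁ (Cliques-≤ (many-cliques lg≤x a<2^lg largeClass bound) cliques)
      where
      lg≤x : lg ≤ x
      lg≤x = ≤-trans (m≤n+m lg n) (≤-trans (+-monoʳ-≤ n (n≤1+n lg)) n+ℓ≤x)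

    step : ∀ {a u} → a ≤ 2 ^ lg → Yields (suc lg) (suc n) (suc x) d a u b w →
      Cliques d X a (2 ^ u) ⊎ Cliques (not d) X b (2 ^ w)
    step {zero}  _ = step-zero
    step {suc a}   = step-suc

  greedy : ∀ lg n → GreedyBound lg n
  greedy lg zero _ _ _ _ _ yields with Yields-[] yields
  ... | inj₁ refl = inj₁ Cliques-1
  ... | inj₂ refl = inj₂ Cliques-1
  greedy lg (suc n) {suc x} {X} {c} {a} {u} {b} {w} n+ℓ≤x uX large a≤ b≤ yields
    with large-class {x} {X} large
  ... | d , largeClass = byColour c d yields largeClass
    where
    step : ∀ d {b w} → b ≤ 2 ^ lg → 2 ^ x ≤ length (class x X d) → ∀ {a u} → a ≤ 2 ^ lg →
      Yields (suc lg) (suc n) (suc x) d a u b w → Cliques d X a (2 ^ u) ⊎ Cliques (not d) X b (2 ^ w)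
    step d b≤ largeClass = Step.step (greedy lg n) (s≤s⁻¹ n+ℓ≤x) uX large b≤ largeClass
    byColour : ∀ c d → Yields (suc lg) (suc n) (suc x) c a u b w → 2 ^ x ≤ length (class x X d) →
      Cliques c X a (2 ^ u) ⊎ Cliques (not c) X b (2 ^ w)
    byColour true  true  yields largeClass = step true b≤ largeClass a≤ yields
    byColour false false yields largeClass = step false b≤ largeClass a≤ yields
    byColour true  false yields largeClass = swap (step false a≤ largeClass b≤ (Yields-swap false yields))
    byColour false true  yields largeClass = swap (step true a≤ largeClass b≤ (Yields-swap true yields))

-- Lower bounds for the yield

trues : List Bool → ℕ
trues []          = 0
trues (true  ∷ P) = suc (trues P)
trues (false ∷ P) = trues P

falses : List Bool → ℕ
falses []          = 0
falses (true  ∷ P) = falses P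
falses (false ∷ P) = suc (falses P)

-- All falses of P if P has fewer than a trues.
falsesBefore : ℕ → List Bool → ℕ
falsesBefore zero    P           = 0
falsesBefore (suc a) []          = 0
falsesBefore (suc a) (true  ∷ P) = falsesBefore a P
falsesBefore (suc a) (false ∷ P) = suc (falsesBefore (suc a) P)

yield-false : ∀ ℓ x b P → yield ℓ (suc x) b (false ∷ P) ≡ yield ℓ x b P
yield-false ℓ x zero    P = refl
yield-false ℓ x (suc b) P = refl

≤-extend : ∀ {L₀ R₀ L R} c d → L ≡ L₀ + c → R ≡ R₀ + (c + d) → L₀ ≤ R₀ → L ≤ R
≤-extend {L₀} {R₀} c d refl refl L₀≤R₀ =
  ≤-trans (+-monoˡ-≤ c L₀≤R₀) (≤-trans (m≤m+n (R₀ + c) d) (≤-reflexive (+-assoc R₀ c d)))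

-- With m = falsesBefore a P, the j-th true of P is taken at level at least x ∸ (j + m), so
-- yield 0 x a P ≥ a x − a (a − 1) / 2 − a m.
yield-lowerBound : ∀ P x a → a ≤ trues P → a + falsesBefore a P ≤ x →
  2 * a * x + a ≤ 2 * yield 0 x a P + a * a + 2 * a * falsesBefore a P
yield-lowerBound P           x       zero    _          _ = z≤n
yield-lowerBound (true  ∷ P) (suc x) (suc a) (s≤s a≤#t) (s≤s a+m≤x) =
  ≤-extend (2 * a + 2 * x + 3) (2 * m) (lhs a x) (rhs a x (yield 0 x a P) m) (yield-lowerBound P x a a≤#t a+m≤x)
  where
  m = falsesBefore a P
  lhs : ∀ a x → 2 * suc a * suc x + suc a ≡ (2 * a * x + a) + (2 * a + 2 * x + 3)
  lhs = solve-∀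
  rhs : ∀ a x Y m → 2 * (suc x + Y) + suc a * suc a + 2 * suc a * m ≡
                    (2 * Y + a * a + 2 * a * m) + ((2 * a + 2 * x + 3) + 2 * m)
  rhs = solve-∀
yield-lowerBound (false ∷ P) (suc x) (suc a) a≤#t a+m≤x =
  ≤-extend (2 * suc a) 0 (lhs (suc a) x) (rhs (suc a) (yield 0 x (suc a) P) m)
    (yield-lowerBound P x (suc a) a≤#t (s≤s⁻¹ (≤-trans (≤-reflexive (sym (+-suc (suc a) m))) a+m≤x)))
  where
  m = falsesBefore (suc a) P
  lhs : ∀ a x → 2 * a * suc x + a ≡ (2 * a * x + a) + 2 * a
  lhs = solve-∀
  rhs : ∀ a Y m → 2 * Y + a * a + 2 * a * suc m ≡ (2 * Y + a * a + 2 * a * m) + (2 * a + 0)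
  rhs = solve-∀

-- The first a + falsesBefore a P steps of P are taken at levels x, x − 1, …; those steps are
-- trues counted by the yield of P or falses counted by the yield of the complement.
yield+yieldᶜ-lowerBound : ∀ P x a b → a ≤ trues P → falsesBefore a P ≤ b → a + falsesBefore a P ≤ x →
  let s = a + falsesBefore a P in
  2 * s * x + s ≤ 2 * (yield 0 x a P + yield 0 x b (List.map not P)) + s * s
yield+yieldᶜ-lowerBound P           x       zero    b _ _ _ = z≤n
yield+yieldᶜ-lowerBound (true  ∷ P) (suc x) (suc a) b (s≤s a≤#t) m≤b (s≤s s≤x) =
  ≤-extend (2 * s + 2 * x + 3) 0 (lhs s x)
    (trans (cong (λ z → 2 * ((suc x + Y) + z) + suc s * suc s) (yield-false 0 x b (List.map not P)))
           (rhs s x Y Yᶜ))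
    (yield+yieldᶜ-lowerBound P x a b a≤#t m≤b s≤x)
  where
  s  = a + falsesBefore a P
  Y  = yield 0 x a P
  Yᶜ = yield 0 x b (List.map not P)
  lhs : ∀ s x → 2 * suc s * suc x + suc s ≡ (2 * s * x + s) + (2 * s + 2 * x + 3)
  lhs = solve-∀
  rhs : ∀ s x Y Yᶜ → 2 * ((suc x + Y) + Yᶜ) + suc s * suc s ≡ (2 * (Y + Yᶜ) + s * s) + ((2 * s + 2 * x + 3) + 0)
  rhs = solve-∀
yield+yieldᶜ-lowerBound (false ∷ P) (suc x) (suc a) (suc b) a≤#t (s≤s m≤b) s≤x =
  ≤-extend (2 * s + 2 * x + 3) 0
    (trans (cong (λ z → 2 * z * suc x + z) (+-suc (suc a) m)) (lhs s x))
    (trans (cong (λ z → 2 * (Y + (suc x + Yᶜ)) + z * z) (+-suc (suc a) m)) (rhs s x Y Yᶜ))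
    (yield+yieldᶜ-lowerBound P x (suc a) b a≤#t m≤b (s≤s⁻¹ (≤-trans (≤-reflexive (sym (+-suc (suc a) m))) s≤x)))
  where
  m  = falsesBefore (suc a) P
  s  = suc a + m
  Y  = yield 0 x (suc a) P
  Yᶜ = yield 0 x b (List.map not P)
  lhs : ∀ s x → 2 * suc s * suc x + suc s ≡ (2 * s * x + s) + (2 * s + 2 * x + 3)
  lhs = solve-∀
  rhs : ∀ s x Y Yᶜ → 2 * (Y + (suc x + Yᶜ)) + suc s * suc s ≡ (2 * (Y + Yᶜ) + s * s) + ((2 * s + 2 * x + 3) + 0)
  rhs = solve-∀

-- The quadratic optimisation

p²≤6q²⇒p≤3q : ∀ p q → p * p ≤ 6 * (q * q) → p ≤ 3 * q
p²≤6q²⇒p≤3q p q p²≤6q² with p ≤? 3 * q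
... | yes p≤3q = p≤3q
... | no  p≰3q = ⊥-elim (<-irrefl refl (<-≤-trans 6q²<p² p²≤6q²))
  where
  expand : ∀ q → suc (3 * q) * suc (3 * q) ≡ suc (6 * (q * q) + (3 * (q * q) + 6 * q))
  expand = solve-∀
  6q²<p² : 6 * (q * q) < p * p
  6q²<p² = ≤-trans (s≤s (m≤m+n (6 * (q * q)) _))
             (≤-trans (≤-reflexive (sym (expand q))) (*-mono-≤ (≰⇒> p≰3q) (≰⇒> p≰3q)))

p²≤6q²⇒ : ∀ p q r → p + r ≡ 3 * q → p * p ≤ 6 * (q * q) → 4 * p * q + r * r ≤ 9 * (q * q) + 2 * q * r
p²≤6q²⇒ p q r p+r≡3q p²≤6q² = *-cancelˡ-≤ 9 (begin
  9 * (4 * p * q + r * r)                   ≡⟨ scale-lhs p q r ⟩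
  12 * p * (3 * q) + 9 * (r * r)            ≡⟨ cong (λ z → 12 * p * z + 9 * (r * r)) (sym p+r≡3q) ⟩
  12 * p * (p + r) + 9 * (r * r)            ≤⟨ +-cancelʳ-≤ (6 * ((p + r) * (p + r))) _ _ rearranged ⟩
  9 * ((p + r) * (p + r)) + 6 * r * (p + r) ≡⟨ cong (λ z → 9 * (z * z) + 6 * r * z) p+r≡3q ⟩
  9 * ((3 * q) * (3 * q)) + 6 * r * (3 * q) ≡⟨ scale-rhs q r ⟩
  9 * (9 * (q * q) + 2 * q * r)             ∎)
  where
  open ≤-Reasoning
  scale-lhs : ∀ p q r → 9 * (4 * p * q + r * r) ≡ 12 * p * (3 * q) + 9 * (r * r)
  scale-lhs = solve-∀
  scale-rhs : ∀ q r → 9 * ((3 * q) * (3 * q)) + 6 * r * (3 * q) ≡ 9 * (9 * (q * q) + 2 * q * r)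
  scale-rhs = solve-∀
  regroup : ∀ p r → 12 * p * (p + r) + 9 * (r * r) + 6 * ((p + r) * (p + r)) ≡
                    9 * ((p + r) * (p + r)) + 6 * r * (p + r) + 9 * (p * p)
  regroup = solve-∀
  scale-6 : ∀ q → 9 * (6 * (q * q)) ≡ 6 * ((3 * q) * (3 * q))
  scale-6 = solve-∀
  9p²≤6[p+r]² : 9 * (p * p) ≤ 6 * ((p + r) * (p + r))
  9p²≤6[p+r]² = begin
    9 * (p * p)             ≤⟨ *-monoʳ-≤ 9 p²≤6q² ⟩
    9 * (6 * (q * q))       ≡⟨ scale-6 q ⟩
    6 * ((3 * q) * (3 * q)) ≡⟨ cong (λ z → 6 * (z * z)) (sym p+r≡3q) ⟩
    6 * ((p + r) * (p + r)) ∎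
  rearranged : 12 * p * (p + r) + 9 * (r * r) + 6 * ((p + r) * (p + r)) ≤
               9 * ((p + r) * (p + r)) + 6 * r * (p + r) + 6 * ((p + r) * (p + r))
  rearranged = ≤-trans (≤-reflexive (regroup p r)) (+-monoʳ-≤ (9 * ((p + r) * (p + r)) + 6 * r * (p + r)) 9p²≤6[p+r]²)

z²-2Qz-antitone : ∀ a z Q → a ≤ z → z ≤ Q → 2 * Q * a + z * z ≤ 2 * Q * z + a * a
z²-2Qz-antitone a z Q a≤z z≤Q with m≤n⇒∃[o]m+o≡n a≤z | m≤n⇒∃[o]m+o≡n z≤Q
... | d , refl | e , refl = ≤-trans (m≤m+n _ (d * d + 2 * d * e)) (≤-reflexive (expand a d e))
  where
  expand : ∀ a d e → 2 * (a + d + e) * a + (a + d) * (a + d) + (d * d + 2 * d * e) ≡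
                     2 * (a + d + e) * (a + d) + a * a
  expand = solve-∀

m+n≤2*[m⊔n] : ∀ m n → m + n ≤ 2 * (m ⊔ n)
m+n≤2*[m⊔n] m n =
  ≤-trans (+-mono-≤ (m≤m⊔n m n) (m≤n⊔m m n)) (≤-reflexive (cong ((m ⊔ n) +_) (sym (+-identityʳ (m ⊔ n)))))

bound-from-first : ∀ k m A q p r → p + r ≡ 3 * q → q * m ≤ r * k → 3 * (k * k) ≤ 2 * A + 2 * k * m →
  2 * p * (k * k) ≤ 2 * q * A + 3 * q * (k * k)
bound-from-first k m A q p r p+r≡3q qm≤rk first = +-cancelʳ-≤ (2 * k * (r * k)) _ _ (begin
  2 * p * (k * k) + 2 * k * (r * k)          ≡⟨ collect p r k ⟩
  2 * (p + r) * (k * k)                      ≡⟨ cong (λ z → 2 * z * (k * k)) p+r≡3q ⟩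
  2 * (3 * q) * (k * k)                      ≡⟨ split q k ⟩
  q * (3 * (k * k)) + 3 * q * (k * k)        ≤⟨ +-monoˡ-≤ (3 * q * (k * k)) scaled ⟩
  (2 * q * A + 2 * k * (r * k)) + 3 * q * (k * k) ≡⟨ swap-last (2 * q * A) (2 * k * (r * k)) (3 * q * (k * k)) ⟩
  (2 * q * A + 3 * q * (k * k)) + 2 * k * (r * k) ∎)
  where
  open ≤-Reasoning
  collect : ∀ p r k → 2 * p * (k * k) + 2 * k * (r * k) ≡ 2 * (p + r) * (k * k)
  collect = solve-∀
  split : ∀ q k → 2 * (3 * q) * (k * k) ≡ q * (3 * (k * k)) + 3 * q * (k * k)
  split = solve-∀
  swap-last : ∀ a b c → (a + b) + c ≡ (a + c) + b
  swap-last = solve-∀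
  distribute : ∀ q A k m → q * (2 * A + 2 * k * m) ≡ 2 * q * A + 2 * k * (q * m)
  distribute = solve-∀
  scaled : q * (3 * (k * k)) ≤ 2 * q * A + 2 * k * (r * k)
  scaled = begin
    q * (3 * (k * k))            ≤⟨ *-monoʳ-≤ q first ⟩
    q * (2 * A + 2 * k * m)      ≡⟨ distribute q A k m ⟩
    2 * q * A + 2 * k * (q * m)  ≤⟨ +-monoʳ-≤ (2 * q * A) (*-monoʳ-≤ (2 * k) qm≤rk) ⟩
    2 * q * A + 2 * k * (r * k)  ∎

-- The second constraint, scaled by q², with m / k replaced by the smaller r / q: this is allowed
-- because 2 z − z² is increasing for z ≤ 1.
second-at-r/q : ∀ k m S q r → r * k ≤ q * m → m ≤ k → 3 * (k * k) + 2 * k * m ≤ 2 * S + m * m →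
  3 * (q * q) * (k * k) + 2 * (q * k) * (r * k) ≤ 2 * (q * q) * S + (r * k) * (r * k)
second-at-r/q k m S q r rk≤qm m≤k second = +-cancelʳ-≤ (2 * Q * z + z * z) _ _ (begin
  (3 * (q * q) * (k * k) + 2 * Q * a) + (2 * Q * z + z * z) ≡⟨ regroup₁ (3 * (q * q) * (k * k)) (2 * Q * a) (2 * Q * z) (z * z) ⟩
  (3 * (q * q) * (k * k) + 2 * Q * z) + (2 * Q * a + z * z) ≤⟨ +-mono-≤ scaled (z²-2Qz-antitone a z Q rk≤qm (*-monoʳ-≤ q m≤k)) ⟩
  (2 * (q * q) * S + z * z) + (2 * Q * z + a * a)           ≡⟨ regroup₂ (2 * (q * q) * S) (z * z) (2 * Q * z) (a * a) ⟩
  (2 * (q * q) * S + a * a) + (2 * Q * z + z * z)           ∎)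
  where
  open ≤-Reasoning
  z = q * m
  a = r * k
  Q = q * k
  regroup₁ : ∀ x y z w → (x + y) + (z + w) ≡ (x + z) + (y + w)
  regroup₁ = solve-∀
  regroup₂ : ∀ x y z w → (x + y) + (z + w) ≡ (x + w) + (z + y)
  regroup₂ = solve-∀
  scale-lhs : ∀ q k m → (q * q) * (3 * (k * k) + 2 * k * m) ≡ 3 * (q * q) * (k * k) + 2 * (q * k) * (q * m)
  scale-lhs = solve-∀
  scale-rhs : ∀ q S m → (q * q) * (2 * S + m * m) ≡ 2 * (q * q) * S + (q * m) * (q * m)
  scale-rhs = solve-∀
  scaled : 3 * (q * q) * (k * k) + 2 * Q * z ≤ 2 * (q * q) * S + z * z
  scaled = begin
    3 * (q * q) * (k * k) + 2 * Q * z    ≡⟨ sym (scale-lhs q k m) ⟩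
    (q * q) * (3 * (k * k) + 2 * k * m)  ≤⟨ *-monoʳ-≤ (q * q) second ⟩
    (q * q) * (2 * S + m * m)            ≡⟨ scale-rhs q S m ⟩
    2 * (q * q) * S + z * z              ∎

bound-from-second : ∀ k m A B q p r → p + r ≡ 3 * q → r * k ≤ q * m → m ≤ k →
  3 * (k * k) + 2 * k * m ≤ 2 * (A + B) + m * m → p * p ≤ 6 * (q * q) →
  2 * q * (2 * p * (k * k)) ≤ 2 * q * (2 * q * (A ⊔ B) + 3 * q * (k * k))
bound-from-second k m A B q p r p+r≡3q rk≤qm m≤k second p²≤6q² = +-cancelʳ-≤ ((r * r) * (k * k)) _ _ (begin
  2 * q * (2 * p * (k * k)) + (r * r) * (k * k)                    ≡⟨ step₁ q p k r ⟩
  (4 * p * q + r * r) * (k * k)                                    ≤⟨ *-monoˡ-≤ (k * k) (p²≤6q²⇒ p q r p+r≡3q p²≤6q²) ⟩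
  (9 * (q * q) + 2 * q * r) * (k * k)                              ≡⟨ step₂ q r k ⟩
  (3 * (q * q) * (k * k) + 2 * (q * k) * (r * k)) + 6 * (q * q) * (k * k)
    ≤⟨ +-monoˡ-≤ (6 * (q * q) * (k * k)) (second-at-r/q k m (A + B) q r rk≤qm m≤k second) ⟩
  (2 * (q * q) * (A + B) + (r * k) * (r * k)) + 6 * (q * q) * (k * k)
    ≤⟨ +-monoˡ-≤ (6 * (q * q) * (k * k)) (+-monoˡ-≤ ((r * k) * (r * k)) (*-monoʳ-≤ (2 * (q * q)) (m+n≤2*[m⊔n] A B))) ⟩
  (2 * (q * q) * (2 * (A ⊔ B)) + (r * k) * (r * k)) + 6 * (q * q) * (k * k) ≡⟨ step₃ q (A ⊔ B) r k ⟩
  2 * q * (2 * q * (A ⊔ B) + 3 * q * (k * k)) + (r * r) * (k * k) ∎)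
  where
  open ≤-Reasoning
  step₁ : ∀ q p k r → 2 * q * (2 * p * (k * k)) + (r * r) * (k * k) ≡ (4 * p * q + r * r) * (k * k)
  step₁ = solve-∀
  step₂ : ∀ q r k → (9 * (q * q) + 2 * q * r) * (k * k) ≡
                    (3 * (q * q) * (k * k) + 2 * (q * k) * (r * k)) + 6 * (q * q) * (k * k)
  step₂ = solve-∀
  step₃ : ∀ q M r k → (2 * (q * q) * (2 * M) + (r * k) * (r * k)) + 6 * (q * q) * (k * k) ≡
                      2 * q * (2 * q * M + 3 * q * (k * k)) + (r * r) * (k * k)
  step₃ = solve-∀

-- The two constraints on A, B and 0 ≤ m ≤ k are what the yield bounds give for a pattern of length
-- 2 k; minimising A ⊔ B subject to them gives (√6 − 3/2) k². With r = 3 q − p, the first constraint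
-- suffices when m / k ≤ r / q, the second one otherwise.
max-lowerBound : ∀ k m A B p q → m ≤ k → 3 * (k * k) ≤ 2 * A + 2 * k * m →
  3 * (k * k) + 2 * k * m ≤ 2 * (A + B) + m * m → p * p ≤ 6 * (q * q) →
  2 * p * (k * k) ≤ 2 * q * (A ⊔ B) + 3 * q * (k * k)
max-lowerBound k m A B zero    zero    _   _     _      _      = z≤n
max-lowerBound k m A B p       (suc q) m≤k first second p²≤6q²
  with p+r≡3q ← m+[n∸m]≡n (p²≤6q²⇒p≤3q p (suc q) p²≤6q²) | suc q * m ≤? (3 * suc q ∸ p) * k
... | yes qm≤rk = ≤-trans (bound-from-first k m A (suc q) p (3 * suc q ∸ p) p+r≡3q qm≤rk first)
                    (+-monoˡ-≤ (3 * suc q * (k * k)) (*-monoʳ-≤ (2 * suc q) (m≤m⊔n A B)))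
... | no  qm≰rk = *-cancelˡ-≤ (2 * suc q)
                    (bound-from-second k m A B (suc q) p (3 * suc q ∸ p) p+r≡3q (<⇒≤ (≰⇒> qm≰rk)) m≤k second p²≤6q²)

-- The yield of the best pattern

maxYield : (ℓ x a : ℕ) → List Bool → ℕ
maxYield ℓ x a P = yield ℓ x a P ⊔ yield ℓ x a (List.map not P)

trues+falses≡length : ∀ P → trues P + falses P ≡ length P
trues+falses≡length []          = refl
trues+falses≡length (true  ∷ P) = cong suc (trues+falses≡length P)
trues+falses≡length (false ∷ P) = trans (+-suc (trues P) (falses P)) (cong suc (trues+falses≡length P))

trues-map-not : ∀ P → trues (List.map not P) ≡ falses P
trues-map-not []          = refl
trues-map-not (true  ∷ P) = trues-map-not P
trues-map-not (false ∷ P) = cong suc (trues-map-not P)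

falses-map-not : ∀ P → falses (List.map not P) ≡ trues P
falses-map-not []          = refl
falses-map-not (true  ∷ P) = cong suc (falses-map-not P)
falses-map-not (false ∷ P) = falses-map-not P

map-not-involutive : ∀ P → List.map not (List.map not P) ≡ P
map-not-involutive P = trans (sym (Listₚ.map-∘ P)) (trans (Listₚ.map-cong not-involutive P) (Listₚ.map-id P))

maxYield-map-not : ∀ ℓ x a P → maxYield ℓ x a (List.map not P) ≡ maxYield ℓ x a P
maxYield-map-not ℓ x a P =
  trans (cong (λ Q → yield ℓ x a (List.map not P) ⊔ yield ℓ x a Q) (map-not-involutive P))
        (⊔-comm (yield ℓ x a (List.map not P)) (yield ℓ x a P))

falsesBefore≤falses : ∀ a P → falsesBefore a P ≤ falses P
falsesBefore≤falses zero    P           = z≤n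
falsesBefore≤falses (suc a) []          = z≤n
falsesBefore≤falses (suc a) (true  ∷ P) = falsesBefore≤falses a P
falsesBefore≤falses (suc a) (false ∷ P) = s≤s (falsesBefore≤falses (suc a) P)

yield-constraints : ∀ k t P → k ≤ trues P → trues P + falses P ≡ k + k → k + k ≤ t →
  let A = yield 0 t k P ; B = yield 0 t k (List.map not P) in
  Σ ℕ λ m → m ≤ k × 3 * (k * k) ≤ 2 * A + 2 * k * m × 3 * (k * k) + 2 * k * m ≤ 2 * (A + B) + m * m
yield-constraints k t P k≤#t #t+#f≡2k 2k≤t = m , m≤k , first , second
  where
  open ≤-Reasoning
  m = falsesBefore k P
  A = yield 0 t k P
  B = yield 0 t k (List.map not P)
  m≤k : m ≤ k
  m≤k = ≤-trans (falsesBefore≤falses k P)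
          (+-cancelˡ-≤ k (falses P) k (≤-trans (+-monoˡ-≤ (falses P) k≤#t) (≤-reflexive #t+#f≡2k)))
  k+m≤t : k + m ≤ t
  k+m≤t = ≤-trans (+-monoʳ-≤ k m≤k) 2k≤t
  first-lhs : ∀ k → 3 * (k * k) + k * k ≡ 2 * k * (k + k)
  first-lhs = solve-∀
  first-rhs : ∀ A k m → 2 * A + k * k + 2 * k * m ≡ (2 * A + 2 * k * m) + k * k
  first-rhs = solve-∀
  first : 3 * (k * k) ≤ 2 * A + 2 * k * m
  first = +-cancelʳ-≤ (k * k) _ _ (begin
    3 * (k * k) + k * k         ≡⟨ first-lhs k ⟩
    2 * k * (k + k)             ≤⟨ *-monoʳ-≤ (2 * k) 2k≤t ⟩
    2 * k * t                   ≤⟨ m≤m+n (2 * k * t) k ⟩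
    2 * k * t + k               ≤⟨ yield-lowerBound P t k k≤#t k+m≤t ⟩
    2 * A + k * k + 2 * k * m   ≡⟨ first-rhs A k m ⟩
    (2 * A + 2 * k * m) + k * k ∎)
  second-lhs : ∀ k m → (3 * (k * k) + 2 * k * m) + (k * k + 2 * k * m) ≡ 2 * (k + m) * (k + k)
  second-lhs = solve-∀
  second-rhs : ∀ S k m → 2 * S + (k + m) * (k + m) ≡ (2 * S + m * m) + (k * k + 2 * k * m)
  second-rhs = solve-∀
  second : 3 * (k * k) + 2 * k * m ≤ 2 * (A + B) + m * m
  second = +-cancelʳ-≤ (k * k + 2 * k * m) _ _ (begin
    (3 * (k * k) + 2 * k * m) + (k * k + 2 * k * m) ≡⟨ second-lhs k m ⟩
    2 * (k + m) * (k + k)                           ≤⟨ *-monoʳ-≤ (2 * (k + m)) 2k≤t ⟩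
    2 * (k + m) * t                                 ≤⟨ m≤m+n _ (k + m) ⟩
    2 * (k + m) * t + (k + m)                       ≤⟨ yield+yieldᶜ-lowerBound P t k k k≤#t m≤k k+m≤t ⟩
    2 * (A + B) + (k + m) * (k + m)                 ≡⟨ second-rhs (A + B) k m ⟩
    (2 * (A + B) + m * m) + (k * k + 2 * k * m)     ∎)

maxYield₀-lowerBound : ∀ k t P → length P ≡ k + k → k + k ≤ t → ∀ p q → p * p ≤ 6 * (q * q) →
  2 * p * (k * k) ≤ 2 * q * maxYield 0 t k P + 3 * q * (k * k)
maxYield₀-lowerBound k t P len 2k≤t p q p²≤6q² with k ≤? trues P
... | yes k≤#t with yield-constraints k t P k≤#t (trans (trues+falses≡length P) len) 2k≤t
...   | m , m≤k , first , second =
  max-lowerBound k m (yield 0 t k P) (yield 0 t k (List.map not P)) p q m≤k first second p²≤6q²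
maxYield₀-lowerBound k t P len 2k≤t p q p²≤6q² | no k≰#t
  with yield-constraints k t (List.map not P) k≤#tᶜ #tᶜ+#fᶜ≡2k 2k≤t
  where
  #t+#f≡2k : trues P + falses P ≡ k + k
  #t+#f≡2k = trans (trues+falses≡length P) len
  k≤#tᶜ : k ≤ trues (List.map not P)
  k≤#tᶜ = subst (k ≤_) (sym (trues-map-not P))
    (+-cancelˡ-≤ (trues P) k (falses P) (≤-trans (+-monoˡ-≤ k (<⇒≤ (≰⇒> k≰#t))) (≤-reflexive (sym #t+#f≡2k))))
  #tᶜ+#fᶜ≡2k : trues (List.map not P) + falses (List.map not P) ≡ k + k
  #tᶜ+#fᶜ≡2k = trans (cong₂ _+_ (trues-map-not P) (falses-map-not P)) (trans (+-comm (falses P) (trues P)) #t+#f≡2k)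
... | m , m≤k , first , second =
  subst (λ M → 2 * p * (k * k) ≤ 2 * q * M + 3 * q * (k * k)) (maxYield-map-not 0 t k P)
    (max-lowerBound k m (yield 0 t k (List.map not P)) (yield 0 t k (List.map not (List.map not P)))
       p q m≤k first second p²≤6q²)

yield₀≤yield+aℓ : ∀ ℓ x a P → yield 0 x a P ≤ yield ℓ x a P + a * ℓ
yield₀≤yield+aℓ ℓ x zero    P           = z≤n
yield₀≤yield+aℓ ℓ x (suc a) []          = z≤n
yield₀≤yield+aℓ ℓ x (suc a) (true  ∷ P) = begin
  x + yield 0 (pred x) a P                               ≤⟨ +-mono-≤ (m≤n+m∸n x ℓ) (yield₀≤yield+aℓ ℓ (pred x) a P) ⟩
  (ℓ + (x ∸ ℓ)) + (yield ℓ (pred x) a P + a * ℓ)        ≡⟨ regroup ℓ (x ∸ ℓ) (yield ℓ (pred x) a P) a ⟩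
  (x ∸ ℓ) + yield ℓ (pred x) a P + suc a * ℓ             ∎
  where
  open ≤-Reasoning
  regroup : ∀ ℓ y Y a → (ℓ + y) + (Y + a * ℓ) ≡ y + Y + suc a * ℓ
  regroup = solve-∀
yield₀≤yield+aℓ ℓ x (suc a) (false ∷ P) = yield₀≤yield+aℓ ℓ (pred x) (suc a) P

maxYield₀≤maxYield+kℓ : ∀ ℓ t k P → maxYield 0 t k P ≤ maxYield ℓ t k P + k * ℓ
maxYield₀≤maxYield+kℓ ℓ t k P = ⊔-lub
  (≤-trans (yield₀≤yield+aℓ ℓ t k P) (+-monoˡ-≤ (k * ℓ) (m≤m⊔n _ _)))
  (≤-trans (yield₀≤yield+aℓ ℓ t k (List.map not P)) (+-monoˡ-≤ (k * ℓ) (m≤n⊔m (yield ℓ t k P) _)))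

lower-order-terms : ∀ k e ℓ → e ≤ suc ℓ → 6 * (e * (4 * k + e)) + 8 * (k * ℓ) ≤ 8 * (3 * suc ℓ * (k + k + e))
lower-order-terms k e ℓ e≤ℓ+1 = begin
  6 * (e * (4 * k + e)) + 8 * (k * ℓ)       ≤⟨ +-monoˡ-≤ (8 * (k * ℓ)) (*-monoʳ-≤ 6 (*-monoˡ-≤ (4 * k + e) e≤ℓ+1)) ⟩
  6 * (suc ℓ * (4 * k + e)) + 8 * (k * ℓ)   ≤⟨ m≤m+n _ _ ⟩
  6 * (suc ℓ * (4 * k + e)) + 8 * (k * ℓ) + (16 * (k * ℓ) + 24 * k + 18 * (e * suc ℓ)) ≡⟨ expand k e ℓ ⟩
  8 * (3 * suc ℓ * (k + k + e))             ∎
  where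
  open ≤-Reasoning
  expand : ∀ k e ℓ → 6 * (suc ℓ * (4 * k + e)) + 8 * (k * ℓ) + (16 * (k * ℓ) + 24 * k + 18 * (e * suc ℓ)) ≡
                     8 * (3 * suc ℓ * (k + k + e))
  expand = solve-∀

maxYield-lowerBound : ∀ k e ℓ P → length P ≡ k + k → e ≤ suc ℓ → ∀ p q → p * p ≤ 6 * (q * q) →
  let t = k + k + e in
  2 * p * (t * t) ≤ 8 * q * maxYield ℓ t k P + 3 * q * (t * t) + 8 * q * (3 * suc ℓ * t)
maxYield-lowerBound k e ℓ P len e≤ℓ+1 p q p²≤6q² = begin
  2 * p * (t * t)                                   ≡⟨ expand-t p k e ⟩
  4 * (2 * p * (k * k)) + 2 * p * D                 ≤⟨ +-mono-≤ (*-monoʳ-≤ 4 main) (*-monoˡ-≤ D 2p≤6q) ⟩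
  4 * (2 * q * M₀ + 3 * q * (k * k)) + 6 * q * D    ≡⟨ regroup₁ q M₀ k D ⟩
  8 * q * M₀ + 12 * q * (k * k) + 6 * q * D         ≤⟨ +-monoˡ-≤ (6 * q * D) (+-monoˡ-≤ (12 * q * (k * k))
                                                         (*-monoʳ-≤ (8 * q) (maxYield₀≤maxYield+kℓ ℓ t k P))) ⟩
  8 * q * (M + k * ℓ) + 12 * q * (k * k) + 6 * q * D ≡⟨ regroup₂ q M k ℓ D ⟩
  8 * q * M + 12 * q * (k * k) + q * (6 * D + 8 * (k * ℓ)) ≤⟨ +-monoʳ-≤ (8 * q * M + 12 * q * (k * k))
                                                         (*-monoʳ-≤ q (lower-order-terms k e ℓ e≤ℓ+1)) ⟩
  8 * q * M + 12 * q * (k * k) + q * (8 * E)        ≤⟨ m≤m+n _ (3 * q * D) ⟩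
  8 * q * M + 12 * q * (k * k) + q * (8 * E) + 3 * q * D ≡⟨ regroup₃ q M k e E ⟩
  8 * q * M + 3 * q * (t * t) + 8 * q * E           ∎
  where
  open ≤-Reasoning
  t = k + k + e
  D = e * (4 * k + e)
  E = 3 * suc ℓ * t
  M₀ = maxYield 0 t k P
  M = maxYield ℓ t k P
  main : 2 * p * (k * k) ≤ 2 * q * M₀ + 3 * q * (k * k)
  main = maxYield₀-lowerBound k t P len (m≤m+n (k + k) e) p q p²≤6q²
  2p≤6q : 2 * p ≤ 6 * q
  2p≤6q = ≤-trans (*-monoʳ-≤ 2 (p²≤6q²⇒p≤3q p q p²≤6q²)) (≤-reflexive (sym (*-assoc 2 3 q)))
  expand-t : ∀ p k e → 2 * p * ((k + k + e) * (k + k + e)) ≡ 4 * (2 * p * (k * k)) + 2 * p * (e * (4 * k + e))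
  expand-t = solve-∀
  regroup₁ : ∀ q M₀ k D → 4 * (2 * q * M₀ + 3 * q * (k * k)) + 6 * q * D ≡ 8 * q * M₀ + 12 * q * (k * k) + 6 * q * D
  regroup₁ = solve-∀
  regroup₂ : ∀ q M k ℓ D → 8 * q * (M + k * ℓ) + 12 * q * (k * k) + 6 * q * D ≡
                           8 * q * M + 12 * q * (k * k) + q * (6 * D + 8 * (k * ℓ))
  regroup₂ = solve-∀
  regroup₃ : ∀ q M k e E → 8 * q * M + 12 * q * (k * k) + q * (8 * E) + 3 * q * (e * (4 * k + e)) ≡
                           8 * q * M + 3 * q * ((k + k + e) * (k + k + e)) + 8 * q * E
  regroup₃ = solve-∀

patterns : ℕ → List (List Bool)
patterns zero    = [] ∷ []
patterns (suc n) = List.map (true ∷_) (patterns n) List.++ List.map (false ∷_) (patterns n)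

∈patterns : ∀ P → P ∈ₗ patterns (length P)
∈patterns []          = here refl
∈patterns (true  ∷ P) = ∈ₚ.∈-++⁺ˡ (∈ₚ.∈-map⁺ (true ∷_) (∈patterns P))
∈patterns (false ∷ P) = ∈ₚ.∈-++⁺ʳ (List.map (true ∷_) (patterns (length P))) (∈ₚ.∈-map⁺ (false ∷_) (∈patterns P))

∈patterns⁻ : ∀ n {P} → P ∈ₗ patterns n → length P ≡ n
∈patterns⁻ zero    (here refl) = refl
∈patterns⁻ (suc n) P∈ with ∈ₚ.∈-++⁻ (List.map (true ∷_) (patterns n)) P∈
... | inj₁ P∈ᵗ with ∈ₚ.∈-map⁻ (true ∷_) P∈ᵗ
...   | P′ , P′∈ , refl = cong suc (∈patterns⁻ n P′∈)
∈patterns⁻ (suc n) P∈ | inj₂ P∈ᶠ with ∈ₚ.∈-map⁻ (false ∷_) P∈ᶠ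
...   | P′ , P′∈ , refl = cong suc (∈patterns⁻ n P′∈)

bestPattern : (ℓ x k : ℕ) → List Bool
bestPattern ℓ x k = argmin (maxYield ℓ x k) (replicate (k + k) true) (patterns (k + k))

optimalYield : (ℓ x k : ℕ) → ℕ
optimalYield ℓ x k = maxYield ℓ x k (bestPattern ℓ x k)

optimalYield≤maxYield : ∀ ℓ x k {P} → length P ≡ k + k → optimalYield ℓ x k ≤ maxYield ℓ x k P
optimalYield≤maxYield ℓ x k {P} len =
  All.lookup (f[argmin]≤f[xs] (replicate (k + k) true) (patterns (k + k))) (subst (λ n → P ∈ₗ patterns n) len (∈patterns P))

length-bestPattern : ∀ ℓ x k → length (bestPattern ℓ x k) ≡ k + k
length-bestPattern ℓ x k with argmin-sel (maxYield ℓ x k) (replicate (k + k) true) (patterns (k + k))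
... | inj₁ ≡default = trans (cong length ≡default) (Listₚ.length-replicate (k + k))
... | inj₂ ∈all     = ∈patterns⁻ (k + k) ∈all

≤⊔⇒≤⊎≤ : ∀ {m} a b → m ≤ a ⊔ b → m ≤ a ⊎ m ≤ b
≤⊔⇒≤⊎≤ a b m≤a⊔b = Sum.map (λ eq → subst (_ ≤_) eq m≤a⊔b) (λ eq → subst (_ ≤_) eq m≤a⊔b) (⊔-sel a b)

optimalYield-yields : ∀ ℓ x k → Yields ℓ (k + k) x true k (optimalYield ℓ x k) k (optimalYield ℓ x k)
optimalYield-yields ℓ x k = mkYields λ P len → ≤⊔⇒≤⊎≤ _ _ (optimalYield≤maxYield ℓ x k len)

Cliques⇒AtLeastGood : ∀ {n} (χ : Colouring n) {t c X k M} → 2 * k ≤ t → Greedy.Cliques χ c X k M → AtLeastGood t χ M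
Cliques⇒AtLeastGood χ {c = c} 2k≤t (f , f-injective , small) =
  f , f-injective , λ i → (c , clique (small i)) , ≤-trans (*-monoʳ-≤ 2 (size (small i))) 2k≤t
  where open Greedy.SmallClique

good-sets : ∀ k e lg → suc lg ≤ e → k + k + e ≤ 2 ^ lg → (χ : Colouring (2 ^ (k + k + e))) →
  AtLeastGood (k + k + e) χ (2 ^ optimalYield (suc lg) (k + k + e) k)
good-sets k e lg lg<e t≤2^lg χ =
  [ Cliques⇒AtLeastGood χ 2k≤t , Cliques⇒AtLeastGood χ 2k≤t ]′
    (Greedy.greedy χ lg (k + k) (+-monoʳ-≤ (k + k) lg<e) (Uniqueₚ.allFin⁺ (2 ^ t))
      (≤-reflexive (sym (Listₚ.length-tabulate id))) k≤2^lg k≤2^lg (optimalYield-yields (suc lg) t k))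
  where
  t = k + k + e
  2k≤t : 2 * k ≤ t
  2k≤t = ≤-trans (≤-reflexive (cong (k +_) (+-identityʳ k))) (m≤m+n (k + k) e)
  k≤2^lg : k ≤ 2 ^ lg
  k≤2^lg = ≤-trans (≤-trans (m≤m+n k k) (m≤m+n (k + k) e)) t≤2^lg

-- The numerical bound

[m*n]^o≡m^o*n^o : ∀ m n o → (m * n) ^ o ≡ m ^ o * n ^ o
[m*n]^o≡m^o*n^o m n zero    = refl
[m*n]^o≡m^o*n^o m n (suc o) = trans (cong (m * n *_) ([m*n]^o≡m^o*n^o m n o)) (interchange m n (m ^ o) (n ^ o))
  where
  interchange : ∀ a b c d → a * b * (c * d) ≡ a * c * (b * d)
  interchange = solve-∀

PowLe-intro : ∀ t T E V → 2 ^ E ≤ V →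
  (∀ p q → p * p ≤ 6 * (q * q) → 2 * p * (t * t) ≤ 8 * q * T + 3 * q * (t * t) + 8 * q * E) →
  PowLe t (2 ^ T * V)
PowLe-intro t T E V 2^E≤V exponents p q p²≤6q² = begin
  2 ^ (2 * p * (t * t))                          ≤⟨ ^-monoʳ-≤ 2 (exponents p q p²≤6q²) ⟩
  2 ^ (8 * q * T + Y + 8 * q * E)                ≡⟨ ^-distribˡ-+-* 2 (8 * q * T + Y) (8 * q * E) ⟩
  2 ^ (8 * q * T + Y) * 2 ^ (8 * q * E)          ≡⟨ cong (_* 2 ^ (8 * q * E)) (^-distribˡ-+-* 2 (8 * q * T) Y) ⟩
  (2 ^ (8 * q * T) * 2 ^ Y) * 2 ^ (8 * q * E)    ≡⟨ cong₂ (λ a b → (a * 2 ^ Y) * b) (2^-8q T) (2^-8q E) ⟩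
  ((2 ^ T) ^ (8 * q) * 2 ^ Y) * (2 ^ E) ^ (8 * q) ≤⟨ *-monoʳ-≤ ((2 ^ T) ^ (8 * q) * 2 ^ Y) (^-monoˡ-≤ (8 * q) 2^E≤V) ⟩
  ((2 ^ T) ^ (8 * q) * 2 ^ Y) * V ^ (8 * q)      ≡⟨ swap-last ((2 ^ T) ^ (8 * q)) (2 ^ Y) (V ^ (8 * q)) ⟩
  ((2 ^ T) ^ (8 * q) * V ^ (8 * q)) * 2 ^ Y      ≡⟨ cong (_* 2 ^ Y) (sym ([m*n]^o≡m^o*n^o (2 ^ T) V (8 * q))) ⟩
  (2 ^ T * V) ^ (8 * q) * 2 ^ Y                  ∎
  where
  open ≤-Reasoning
  Y = 3 * q * (t * t)
  comm : ∀ q a → 8 * q * a ≡ a * (8 * q)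
  comm = solve-∀
  2^-8q : ∀ a → 2 ^ (8 * q * a) ≡ (2 ^ a) ^ (8 * q)
  2^-8q a = trans (cong (2 ^_) (comm q a)) (sym (^-*-assoc 2 a (8 * q)))
  swap-last : ∀ a b c → (a * b) * c ≡ (a * c) * b
  swap-last = solve-∀

2^[3st]≤t^[6t] : ∀ s t → 2 ^ s ≤ t * t → 2 ^ (3 * s * t) ≤ t ^ (6 * t)
2^[3st]≤t^[6t] s t 2^s≤t² = begin
  2 ^ (3 * s * t)            ≡⟨ cong (2 ^_) (reassoc s t) ⟩
  2 ^ (s * (3 * t))          ≡⟨ sym (^-*-assoc 2 s (3 * t)) ⟩
  (2 ^ s) ^ (3 * t)          ≤⟨ ^-monoˡ-≤ (3 * t) 2^s≤t² ⟩
  (t * t) ^ (3 * t)          ≡⟨ [m*n]^o≡m^o*n^o t t (3 * t) ⟩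
  t ^ (3 * t) * t ^ (3 * t)  ≡⟨ sym (^-distribˡ-+-* t (3 * t) (3 * t)) ⟩
  t ^ (3 * t + 3 * t)        ≡⟨ cong (t ^_) (double t) ⟩
  t ^ (6 * t)                ∎
  where
  open ≤-Reasoning
  reassoc : ∀ s t → 3 * s * t ≡ s * (3 * t)
  reassoc = solve-∀
  double : ∀ t → 3 * t + 3 * t ≡ 6 * t
  double = solve-∀

-- The loss 3 (ℓ + 1) t in maxYield-lowerBound is at most log₂ t ^ (6 t), as 2 ^ (ℓ + 1) ≤ t².
optimalYield-PowLe : ∀ k e lg → e ≤ suc (suc lg) → 2 ^ suc (suc lg) ≤ (k + k + e) * (k + k + e) →
  PowLe (k + k + e) (2 ^ optimalYield (suc lg) (k + k + e) k * (k + k + e) ^ (6 * (k + k + e)))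
optimalYield-PowLe k e lg e≤ℓ+1 2^[ℓ+1]≤t² =
  PowLe-intro t (optimalYield ℓ t k) (3 * suc ℓ * t) (t ^ (6 * t)) (2^[3st]≤t^[6t] (suc ℓ) t 2^[ℓ+1]≤t²)
    (maxYield-lowerBound k e ℓ (bestPattern ℓ t k) (length-bestPattern ℓ t k) e≤ℓ+1)
  where
  t = k + k + e
  ℓ = suc lg

power-of-two-between : ∀ n → Σ ℕ λ lg → suc n ≤ 2 ^ lg × 2 ^ lg ≤ 2 * suc n
power-of-two-between zero = 0 , s≤s z≤n , s≤s z≤n
power-of-two-between (suc n) with power-of-two-between n
... | lg , n<2^lg , 2^lg≤2[n+1] with suc (suc n) ≤? 2 ^ lg
...   | yes n+1<2^lg = lg , n+1<2^lg , ≤-trans 2^lg≤2[n+1] (*-monoʳ-≤ 2 (n≤1+n (suc n)))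
...   | no  n+1≮2^lg = suc lg , subst (λ z → suc (suc n) ≤ 2 * z) (sym 2^lg≡n+1) (≤-trans (m≤m+n (suc (suc n)) n) (≤-reflexive (double n)))
                              , subst (λ z → 2 * z ≤ 2 * suc (suc n)) (sym 2^lg≡n+1) (*-monoʳ-≤ 2 (n≤1+n (suc n)))
  where
  2^lg≡n+1 : 2 ^ lg ≡ suc n
  2^lg≡n+1 = ≤-antisym (s≤s⁻¹ (≰⇒> n+1≮2^lg)) n<2^lg
  double : ∀ n → suc (suc n) + n ≡ 2 * suc n
  double = solve-∀

halve : ∀ n → Σ ℕ λ k → Σ ℕ λ e → k + k + e ≡ n × e ≤ 1
halve zero = 0 , 0 , refl , z≤n
halve (suc n) with halve n
... | k , zero , refl , _ = k , 1 , even k , s≤s z≤n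
  where
  even : ∀ k → k + k + 1 ≡ suc (k + k + 0)
  even = solve-∀
... | k , suc zero , refl , _ = suc k , 0 , odd k , z≤n
  where
  odd : ∀ k → suc k + suc k + 0 ≡ suc (k + k + 1)
  odd = solve-∀
... | k , suc (suc e) , _ , s≤s ()

n+4≤2^[n+2] : ∀ n → n + 4 ≤ 2 ^ suc (suc n)
n+4≤2^[n+2] zero    = ≤-refl
n+4≤2^[n+2] (suc n) = begin
  suc n + 4                          ≡⟨ +-comm 1 (n + 4) ⟩
  (n + 4) + 1                        ≤⟨ +-mono-≤ (n+4≤2^[n+2] n) (m^n>0 2 (suc (suc n))) ⟩
  2 ^ suc (suc n) + 2 ^ suc (suc n)  ≡⟨ cong (2 ^ suc (suc n) +_) (sym (+-identityʳ (2 ^ suc (suc n)))) ⟩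
  2 ^ suc (suc (suc n))              ∎
  where open ≤-Reasoning

2^lg≤2t⇒lg<t : ∀ lg t → 8 ≤ t → 2 ^ lg ≤ 2 * t → suc lg ≤ t
2^lg≤2t⇒lg<t zero                t 8≤t _ = ≤-trans (s≤s z≤n) 8≤t
2^lg≤2t⇒lg<t (suc zero)          t 8≤t _ = ≤-trans (s≤s (s≤s z≤n)) 8≤t
2^lg≤2t⇒lg<t (suc (suc zero))    t 8≤t _ = ≤-trans (s≤s (s≤s (s≤s z≤n))) 8≤t
2^lg≤2t⇒lg<t (suc (suc (suc n))) t 8≤t 2^lg≤2t =
  subst (_≤ t) (+-comm n 4) (*-cancelˡ-≤ 2 (≤-trans (*-monoʳ-≤ 2 (n+4≤2^[n+2] n)) 2^lg≤2t))

2^[lg+2]≤t² : ∀ lg t → 8 ≤ t → 2 ^ lg ≤ 2 * t → 2 ^ suc (suc lg) ≤ t * t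
2^[lg+2]≤t² lg t 8≤t 2^lg≤2t = begin
  2 * (2 * 2 ^ lg)   ≤⟨ *-monoʳ-≤ 2 (*-monoʳ-≤ 2 2^lg≤2t) ⟩
  2 * (2 * (2 * t))  ≡⟨ eight t ⟩
  8 * t              ≤⟨ *-monoˡ-≤ t 8≤t ⟩
  t * t              ∎
  where
  open ≤-Reasoning
  eight : ∀ t → 2 * (2 * (2 * t)) ≡ 8 * t
  eight = solve-∀

-- Patterns have length 2 k, and e ≈ log₂ t pays both for the rounding and for ℓ = lg + 1.
record Decomposition (t : ℕ) : Set where
  constructor decomposition
  field
    k e lg      : ℕ
    k+k+e≡t     : k + k + e ≡ t
    lg<e        : suc lg ≤ e
    e≤lg+2      : e ≤ suc (suc lg)
    t≤2^lg      : t ≤ 2 ^ lg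
    2^lg+2≤t²   : 2 ^ suc (suc lg) ≤ t * t

decompose : ∀ t → 8 ≤ t → Decomposition t
decompose (suc t) 8≤t with power-of-two-between t
... | lg , t<2^lg , 2^lg≤2t with halve (suc t ∸ suc lg)
...   | k , e′ , k+k+e′≡ , e′≤1 =
  decomposition k (e′ + suc lg) lg k+k+e≡t (m≤n+m (suc lg) e′) (+-monoˡ-≤ (suc lg) e′≤1) t<2^lg
    (2^[lg+2]≤t² lg (suc t) 8≤t 2^lg≤2t)
  where
  k+k+e≡t : k + k + (e′ + suc lg) ≡ suc t
  k+k+e≡t = trans (sym (+-assoc (k + k) e′ (suc lg)))
              (trans (cong (_+ suc lg) k+k+e′≡) (m∸n+n≡m (2^lg≤2t⇒lg<t lg (suc t) 8≤t 2^lg≤2t)))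

mainTheorem7 : Σ ℕ λ C → 0 < C × Σ ℕ λ t₀ → ∀ (t : ℕ) → t₀ ≤ t →
    ∀ (χ : Colouring (2 ^ t)) → Σ ℕ λ N → AtLeastGood t χ N × PowLe t (N * t ^ (C * t))
mainTheorem7 = 6 , s≤s z≤n , 8 , λ t 8≤t → bound t (decompose t 8≤t)
  where
  bound : ∀ t → Decomposition t → (χ : Colouring (2 ^ t)) →
    Σ ℕ λ N → AtLeastGood t χ N × PowLe t (N * t ^ (6 * t))
  bound _ (decomposition k e lg refl lg<e e≤lg+2 t≤2^lg 2^lg+2≤t²) χ =
    2 ^ optimalYield (suc lg) (k + k + e) k ,
    good-sets k e lg lg<e t≤2^lg χ ,
    optimalYield-PowLe k e lg e≤lg+2 2^lg+2≤t²
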